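{- Let $\Phi=\tfrac12(1+\sqrt{5})$. For all positive integers $n$, $$\{\lfloor n\Phi\rfloor \Phi\}<\Phi-1 \quad\Longleftrightarrow\quad \{\lfloor n\Phi\rfloor \Phi\}<\{n\Phi\}.$$
   Context: For a real number $t$, $\lfloor t\rfloor$ denotes the largest integer not exceeding $t$ and $\{t\}=t-\lfloor t\rfloor$ denotes its fractional part. -}

module Defs where

open import Data.Integer using (ℤ; +_; _+_; _-_; _*_; _<_; _≤_; -_)
open import Data.Product using (_×_)
open import Data.Sum using (_⊎_)
open import Relation.Binary.PropositionalEquality using (_≡_)

-- Elements of ℤ[Φ], Φ = (1 + √5)/2 : the pair (a , b) denotes the real a + b·Φ.
-- Since 1, Φ are linearly independent over ℚ, this representation is unique,
-- so propositional equality of pairs is equality of the real numbers.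
record ℤΦ : Set where
  constructor _⊕_Φ
  field
    re : ℤ
    co : ℤ
open ℤΦ public

ι : ℤ → ℤΦ
ι m = m ⊕ (+ 0) Φ

Φ : ℤΦ
Φ = (+ 0) ⊕ (+ 1) Φ

_+Φ_ : ℤΦ → ℤΦ → ℤΦ
x +Φ y = (re x + re y) ⊕ (co x + co y) Φ

_-Φ_ : ℤΦ → ℤΦ → ℤΦ
x -Φ y = (re x - re y) ⊕ (co x - co y) Φ

_·Φ_ : ℤ → ℤΦ → ℤΦ
m ·Φ x = (m * re x) ⊕ (m * co x) Φ

-- Exact sign test: the real number u + q·√5 (u, q integers) is > 0.
Pos√5 : ℤ → ℤ → Set
Pos√5 u q =
    (+ 0 ≤ u × + 0 ≤ q × (+ 0 < u ⊎ + 0 < q))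
  ⊎ (+ 0 < u × q < + 0 × (+ 5) * (q * q) < u * u)
  ⊎ (u < + 0 × + 0 < q × u * u < (+ 5) * (q * q))

-- a + bΦ > 0  iff  2(a + bΦ) = (2a + b) + b√5 > 0.
Positive : ℤΦ → Set
Positive x = Pos√5 ((+ 2) * re x + co x) (co x)

_<Φ_ : ℤΦ → ℤΦ → Set
x <Φ y = Positive (y -Φ x)

_≤Φ_ : ℤΦ → ℤΦ → Set
x ≤Φ y = x <Φ y ⊎ x ≡ y

IsFloor : ℤΦ → ℤ → Set
IsFloor x m = ι m ≤Φ x × x <Φ ι (m + + 1)

frac : ℤΦ → ℤ → ℤΦ
frac x m = x -Φ ι m

module Submission where

-- Let n ≥ 1, m = ⌊nΦ⌋ and r = ⌊mΦ⌋.  Since bΦ is the positive root of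
-- a² - ab - b², the integer  Q b a = a² - ab - b²  decides on which side of
-- bΦ an integer a ≥ 0 lies (aboveΦ, belowΦ).
--
-- Consequently  r = ⌊bΦ⌋  is described by the integer conditions FloorΦ b r,
-- which determine r.  From them we get the Beatty identity
-- ⌊⌊nΦ⌋Φ⌋ = m + n - 1 together with n ≤ m (floor-of-floor).  With
-- r = m + n - 1 the two differences compared in the theorem are
--   (Φ - 1) - {mΦ} = (m + n - 2) - (m - 1)Φ   and   {nΦ} - {mΦ} = (n - 1) - (m - n)Φ,
-- and each is positive exactly when  m - 1 < (n - 1)Φ  (frac-comparison).

open import Defs
open import Data.Nat using (ℕ; suc; z≤n; s≤s)
open import Data.Integer using (ℤ; +_; -[1+_]; _+_; _-_; _*_; -_; _≤_; _<_; +≤+; +<+; -<+)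
open import Data.Integer.Properties
  using (+-mono-≤; pos-*; i≤j⇒0≤j-i; 0≤i-j⇒j≤i; i<j⇒suc[i]≤j; suc[i]≤j⇒i<j;
         ≤-antisym; ≤-trans; +-monoˡ-≤; <⇒≤; <⇒≱; ≰⇒>; <-asym; <-irrefl; <-≤-trans; neg-mono-≤; *-identityʳ)
open import Data.Integer.Tactic.RingSolver using (solve)
open import Data.List using (_∷_; [])
open import Data.Product using (_×_; _,_; proj₁; proj₂)
open import Data.Sum using (_⊎_; inj₁; inj₂)
open import Data.Empty using (⊥; ⊥-elim)
open import Relation.Binary.PropositionalEquality using (_≡_; refl; subst; sym; cong; cong₂; trans)
open import Function.Bundles using (_⇔_; mk⇔; Equivalence)
open import Function.Properties.Equivalence using () renaming (refl to ⇔-refl; trans to ⇔-trans; sym to ⇔-sym)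

0≤+ : ∀ {a b} → + 0 ≤ a → + 0 ≤ b → + 0 ≤ a + b
0≤+ = +-mono-≤

0≤* : ∀ {a b} → + 0 ≤ a → + 0 ≤ b → + 0 ≤ a * b
0≤* {+ a} {+ b} _ _ = subst (+ 0 ≤_) (pos-* a b) (+≤+ z≤n)

0≤ℕ : ∀ k → + 0 ≤ + k
0≤ℕ k = +≤+ z≤n

rearrange : ∀ {a} b → + 0 ≤ a → a ≡ b → + 0 ≤ b
rearrange _ p refl = p

refute : ∀ {a} k → + 0 ≤ a → a ≡ -[1+ k ] → ⊥
refute k () refl

≤⇒0≤ : ∀ {a b} → a ≤ b → + 0 ≤ b - a
≤⇒0≤ = i≤j⇒0≤j-i

0≤⇒≤ : ∀ {a b} → + 0 ≤ b - a → a ≤ b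
0≤⇒≤ = 0≤i-j⇒j≤i

<⇒0≤ : ∀ {a b} → a < b → + 0 ≤ b - a - + 1
<⇒0≤ {a} {b} a<b = rearrange {b - (+ 1 + a)} (b - a - + 1) (≤⇒0≤ (i<j⇒suc[i]≤j a<b)) (solve (a ∷ b ∷ []))

0≤⇒< : ∀ {a b} → + 0 ≤ b - a - + 1 → a < b
0≤⇒< {a} {b} h = suc[i]≤j⇒i<j (0≤⇒≤ (rearrange (b - (+ 1 + a)) h (solve (a ∷ b ∷ []))))

0≤⇒0<+1 : ∀ {a} → + 0 ≤ a → + 0 < a + + 1
0≤⇒0<+1 {a} 0≤a = 0≤⇒< (rearrange (a + + 1 - + 0 - + 1) 0≤a (solve (a ∷ [])))

sign : ∀ x → + 0 ≤ x ⊎ x < + 0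
sign (+ k) = inj₁ (0≤ℕ k)
sign -[1+ k ] = inj₂ -<+

0≤square : ∀ x → + 0 ≤ x * x
0≤square (+ k) = 0≤* (0≤ℕ k) (0≤ℕ k)
0≤square -[1+ k ] = 0≤* (0≤ℕ (suc k)) (0≤ℕ (suc k))

pos√5-nonpos : ∀ {u q} → q ≤ + 0 → Pos√5 u q ⇔ (+ 0 < u × + 5 * (q * q) < u * u)
pos√5-nonpos {u} {q} q≤0 = mk⇔ to from
  where
  to : Pos√5 u q → + 0 < u × + 5 * (q * q) < u * u
  to (inj₁ (_ , 0≤q , inj₁ 0<u)) = 0<u , 0≤⇒< (rearrange (u * u - + 5 * (q * q) - + 1)
    (0≤+ (0≤+ (0≤square (u - + 1)) (0≤* (0≤ℕ 2) (<⇒0≤ 0<u))) (0≤* (0≤ℕ 5) (0≤* 0≤q (≤⇒0≤ q≤0))))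
    (solve (u ∷ q ∷ [])))
  to (inj₁ (_ , _ , inj₂ 0<q)) = ⊥-elim (<⇒≱ 0<q q≤0)
  to (inj₂ (inj₁ (0<u , _ , lt))) = 0<u , lt
  to (inj₂ (inj₂ (_ , 0<q , _))) = ⊥-elim (<⇒≱ 0<q q≤0)
  from : + 0 < u × + 5 * (q * q) < u * u → Pos√5 u q
  from (0<u , lt) with sign q
  ... | inj₁ 0≤q = inj₁ (<⇒≤ 0<u , 0≤q , inj₁ 0<u)
  ... | inj₂ q<0 = inj₂ (inj₁ (0<u , q<0 , lt))

pos√5-pos : ∀ {u q} → + 0 < q → Pos√5 u q → + 0 ≤ u ⊎ u * u < + 5 * (q * q)
pos√5-pos _   (inj₁ (0≤u , _)) = inj₁ 0≤u
pos√5-pos 0<q (inj₂ (inj₁ (_ , q<0 , _))) = ⊥-elim (<-asym 0<q q<0)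
pos√5-pos _   (inj₂ (inj₂ (_ , _ , lt))) = inj₂ lt

-- bΦ is the positive root of  Q b a = a² - ab - b²  (as a function of a).
Q : ℤ → ℤ → ℤ
Q b a = a * a - a * b - b * b
-- Inlined, so that the ring solver sees the polynomial rather than the name Q.
{-# INLINE Q #-}

-- If c > 0 lies above the root bΦ, then c > b  (as Q b c ≤ -b² when 0 < c ≤ b).
Q-pos⇒> : ∀ {b c} → + 0 < c → + 0 < Q b c → b < c
Q-pos⇒> {b} {c} 0<c 0<Qc = ≰⇒> λ (c≤b : c ≤ b) → refute 0
  (0≤+ (0≤+ (<⇒0≤ 0<Qc) (0≤* (0≤+ (<⇒0≤ 0<c) (0≤ℕ 1)) (≤⇒0≤ c≤b))) (0≤square b))
  (solve (b ∷ c ∷ []))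

-- Q b is increasing beyond the root: if Q b a < 0 < Q b c with c > 0, then a < c.
Q-sandwich : ∀ {a b c} → + 0 < c → + 0 < Q b c → Q b a < + 0 → a < c
Q-sandwich {a} {b} {c} 0<c 0<Qc Qa<0 = ≰⇒> λ (c≤a : c ≤ a) → refute 1
  (0≤+ (0≤+ (0≤+ (<⇒0≤ Qa<0) (<⇒0≤ 0<Qc))
                 (0≤* (≤⇒0≤ c≤a) (0≤+ (≤⇒0≤ c≤a) (<⇒0≤ b<c))))
       (0≤* (≤⇒0≤ c≤a) (0≤+ (<⇒0≤ 0<c) (0≤ℕ 2))))
  (solve (a ∷ b ∷ c ∷ []))
  where
  b<c : b < c
  b<c = Q-pos⇒> 0<c 0<Qc

-- Below the root everything is less than 2b  (Φ < 2).
Q-neg⇒<2b : ∀ {a b} → + 0 ≤ b → Q b a < + 0 → a < + 2 * b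
Q-neg⇒<2b {a} {b} 0≤b Qa<0 = ≰⇒> λ (2b≤a : + 2 * b ≤ a) → refute 0
  (0≤+ (0≤+ (0≤+ (<⇒0≤ Qa<0) (0≤square (a - + 2 * b)))
            (0≤* (0≤* (0≤ℕ 3) 0≤b) (≤⇒0≤ 2b≤a)))
       (0≤square b))
  (solve (a ∷ b ∷ []))

-- Q 0 a = a² is never negative, so Q b a < 0 with b ≥ 0 forces b > 0.
Q-neg⇒0<b : ∀ {a b} → + 0 ≤ b → + 0 ≤ a → Q b a < + 0 → + 0 < b
Q-neg⇒0<b {a} {b} 0≤b 0≤a Qa<0 = ≰⇒> λ (b≤0 : b ≤ + 0) → refute 0
  (0≤+ (0≤+ (0≤+ (<⇒0≤ Qa<0) (0≤square a)) (0≤* 0≤a (≤⇒0≤ b≤0))) (0≤* 0≤b (≤⇒0≤ b≤0)))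
  (solve (a ∷ b ∷ []))

aboveΦ : ∀ {a b} → + 0 ≤ b → Positive (a ⊕ (- b) Φ) ⇔ (+ 0 < a × + 0 < Q b a)
aboveΦ {a} {b} 0≤b = ⇔-trans (pos√5-nonpos (neg-mono-≤ 0≤b)) (mk⇔ to from)
  where
  -- Here u = 2a - b and  u² - 5b² = 4 · Q b a.
  to : + 0 < + 2 * a + - b × + 5 * (- b * - b) < (+ 2 * a + - b) * (+ 2 * a + - b)
     → + 0 < a × + 0 < Q b a
  to (0<u , disc) =
      ≰⇒> (λ (a≤0 : a ≤ + 0) → refute 0
             (0≤+ (0≤+ (<⇒0≤ 0<u) (0≤* (0≤ℕ 2) (≤⇒0≤ a≤0))) 0≤b) (solve (a ∷ b ∷ [])))
    , ≰⇒> (λ (Q≤0 : Q b a ≤ + 0) → refute 0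
             (0≤+ (<⇒0≤ disc) (0≤* (0≤ℕ 4) (≤⇒0≤ Q≤0))) (solve (a ∷ b ∷ [])))
  from : + 0 < a × + 0 < Q b a
       → + 0 < + 2 * a + - b × + 5 * (- b * - b) < (+ 2 * a + - b) * (+ 2 * a + - b)
  from (0<a , 0<Q) =
      0≤⇒< (rearrange (+ 2 * a + - b - + 0 - + 1)
             (0≤+ (<⇒0≤ (Q-pos⇒> 0<a 0<Q)) (0≤+ (<⇒0≤ 0<a) (0≤ℕ 1))) (solve (a ∷ b ∷ [])))
    , 0≤⇒< (rearrange ((+ 2 * a + - b) * (+ 2 * a + - b) - + 5 * (- b * - b) - + 1)
             (0≤+ (0≤* (0≤ℕ 4) (<⇒0≤ 0<Q)) (0≤ℕ 3)) (solve (a ∷ b ∷ [])))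

belowΦ : ∀ {a b} → + 0 < b → + 0 ≤ a → Positive ((- a) ⊕ b Φ) → Q b a < + 0
belowΦ {a} {b} 0<b 0≤a pos = from-sign-test (pos√5-pos 0<b pos)
  where
  -- Here u = b - 2a and  5b² - u² = -4 · Q b a.
  from-sign-test : + 0 ≤ + 2 * - a + b ⊎ (+ 2 * - a + b) * (+ 2 * - a + b) < + 5 * (b * b)
                 → Q b a < + 0
  from-sign-test (inj₁ 0≤u) = ≰⇒> λ (0≤Q : + 0 ≤ Q b a) → refute 0
    (0≤+ (0≤+ (0≤+ (0≤+ (≤⇒0≤ 0≤Q) (0≤* 0≤a 0≤u)) (0≤square a)) (0≤square (b - + 1)))
         (0≤* (0≤ℕ 2) (<⇒0≤ 0<b)))
    (solve (a ∷ b ∷ []))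
  from-sign-test (inj₂ disc) = ≰⇒> λ (0≤Q : + 0 ≤ Q b a) → refute 0
    (0≤+ (<⇒0≤ disc) (0≤* (0≤ℕ 4) (≤⇒0≤ 0≤Q)))
    (solve (a ∷ b ∷ []))

ℤΦ-ext : ∀ {a b c d} → a ≡ c → b ≡ d → a ⊕ b Φ ≡ c ⊕ d Φ
ℤΦ-ext = cong₂ _⊕_Φ

positive-≡ : ∀ {x y} → x ≡ y → Positive x ⇔ Positive y
positive-≡ refl = ⇔-refl

-- Integer description of  r = ⌊bΦ⌋  for b > 0:  0 ≤ r < bΦ < r + 1.
FloorΦ : ℤ → ℤ → Set
FloorΦ b r = + 0 ≤ r × Q b r < + 0 × + 0 < Q b (r + + 1)

-- The real floor condition implies the integer one.  The lower bound r ≤ bΦ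
-- is strict because bΦ is irrational (its Φ-coordinate b is nonzero).
IsFloor⇒FloorΦ : ∀ {b r} → + 0 < b → IsFloor (b ·Φ Φ) r → FloorΦ b r
IsFloor⇒FloorΦ {b} {r} 0<b (r≤bΦ , bΦ<r+1) = 0≤r , strict r≤bΦ , 0<Q[r+1]
  where
  upper-form : ι (r + + 1) -Φ (b ·Φ Φ) ≡ (r + + 1) ⊕ (- b) Φ
  upper-form = ℤΦ-ext {(r + + 1) - b * + 0} {+ 0 - b * + 1} (solve (b ∷ r ∷ [])) (solve (b ∷ []))
  lower-form : (b ·Φ Φ) -Φ ι r ≡ (- r) ⊕ b Φ
  lower-form = ℤΦ-ext {b * + 0 - r} {b * + 1 - + 0} (solve (b ∷ r ∷ [])) (solve (b ∷ []))
  upper : + 0 < r + + 1 × + 0 < Q b (r + + 1)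
  upper = Equivalence.to (aboveΦ (<⇒≤ 0<b)) (subst Positive upper-form bΦ<r+1)
  0<Q[r+1] : + 0 < Q b (r + + 1)
  0<Q[r+1] = proj₂ upper
  0≤r : + 0 ≤ r
  0≤r = rearrange r (<⇒0≤ (proj₁ upper)) (solve (r ∷ []))
  strict : ι r ≤Φ (b ·Φ Φ) → Q b r < + 0
  strict (inj₁ r<bΦ) = belowΦ 0<b 0≤r (subst Positive lower-form r<bΦ)
  strict (inj₂ r≡bΦ) = ⊥-elim (<-irrefl (trans (cong co r≡bΦ) (*-identityʳ b)) 0<b)

-- FloorΦ b r determines r: Q b is increasing beyond its root.
FloorΦ-unique : ∀ {b r s} → FloorΦ b r → FloorΦ b s → r ≡ s
FloorΦ-unique {b} (0≤r , Qr<0 , 0<Q[r+1]) (0≤s , Qs<0 , 0<Q[s+1]) =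
  ≤-antisym (below-successor 0≤s 0<Q[s+1] Qr<0) (below-successor 0≤r 0<Q[r+1] Qs<0)
  where
  below-successor : ∀ {x y} → + 0 ≤ y → + 0 < Q b (y + + 1) → Q b x < + 0 → x ≤ y
  below-successor {x} {y} 0≤y 0<Q[y+1] Qx<0 = 0≤⇒≤ (rearrange (y - x)
    (<⇒0≤ (Q-sandwich {x} {b} {y + + 1} (0≤⇒0<+1 0≤y) 0<Q[y+1] Qx<0))
    (solve (x ∷ y ∷ [])))

-- For n ≥ 0, m = ⌊nΦ⌋ lies in [n, 2n)  (because 1 < Φ < 2).
FloorΦ-range : ∀ {n m} → + 0 ≤ n → FloorΦ n m → n ≤ m × m < + 2 * n
FloorΦ-range {n} {m} 0≤n (0≤m , Qm<0 , 0<Q[m+1]) =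
    0≤⇒≤ (rearrange (m - n) (<⇒0≤ (Q-pos⇒> {n} {m + + 1} (0≤⇒0<+1 0≤m) 0<Q[m+1])) (solve (m ∷ n ∷ [])))
  , Q-neg⇒<2b 0≤n Qm<0

-- Beatty step: if m = ⌊nΦ⌋ with n > 0, then m + n - 1 = ⌊mΦ⌋, because
--   Q m (m + n) = - Q n m   and   Q m (m + n - 1) = - Q n (m + 1) - (3n - m - 2).
FloorΦ-next : ∀ {n m} → + 0 < n → FloorΦ n m → FloorΦ m (m + n - + 1)
FloorΦ-next {n} {m} 0<n Fm@(0≤m , Qm<0 , 0<Q[m+1]) =
    rearrange (m + n - + 1) (0≤+ 0≤m (<⇒0≤ 0<n)) (solve (m ∷ n ∷ []))
  , ≰⇒> (λ (0≤Q : + 0 ≤ Q m (m + n - + 1)) → refute 0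
      (0≤+ (0≤+ (0≤+ (≤⇒0≤ 0≤Q) (<⇒0≤ 0<Q[m+1])) (<⇒0≤ m<2n)) (<⇒0≤ 0<n))
      (solve (m ∷ n ∷ [])))
  , 0≤⇒< (rearrange (Q m (m + n - + 1 + + 1) - + 0 - + 1) (<⇒0≤ Qm<0) (solve (m ∷ n ∷ [])))
  where
  m<2n : m < + 2 * n
  m<2n = proj₂ (FloorΦ-range (<⇒≤ 0<n) Fm)

floor-of-floor : ∀ {n m r} → + 0 < n → IsFloor (n ·Φ Φ) m → IsFloor (m ·Φ Φ) r
               → n ≤ m × r ≡ m + n - + 1
floor-of-floor {n} {m} {r} 0<n floor-n floor-m =
  n≤m , FloorΦ-unique (IsFloor⇒FloorΦ (<-≤-trans 0<n n≤m) floor-m) (FloorΦ-next 0<n Fm)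
  where
  Fm : FloorΦ n m
  Fm = IsFloor⇒FloorΦ 0<n floor-n
  n≤m : n ≤ m
  n≤m = proj₁ (FloorΦ-range (<⇒≤ 0<n) Fm)

-- For 0 ≤ s ≤ p both sides below say  p < sΦ, since
--   Q p (p + s) = Q (p - s) s = - Q s p,
-- and Q s p < 0 already forces s > 0.
criterion-A : ∀ {p s} → + 0 ≤ s → + 0 ≤ p
            → (+ 0 < p + s × + 0 < Q p (p + s)) ⇔ Q s p < + 0
criterion-A {p} {s} 0≤s 0≤p = mk⇔ to from
  where
  to : + 0 < p + s × + 0 < Q p (p + s) → Q s p < + 0
  to (_ , 0<Q) = ≰⇒> λ (0≤Q : + 0 ≤ Q s p) → refute 0
    (0≤+ (<⇒0≤ 0<Q) (≤⇒0≤ 0≤Q)) (solve (p ∷ s ∷ []))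
  from : Q s p < + 0 → + 0 < p + s × + 0 < Q p (p + s)
  from Q<0 =
      0≤⇒< (rearrange (p + s - + 0 - + 1) (0≤+ 0≤p (<⇒0≤ (Q-neg⇒0<b 0≤s 0≤p Q<0))) (solve (p ∷ s ∷ [])))
    , 0≤⇒< (rearrange (Q p (p + s) - + 0 - + 1) (<⇒0≤ Q<0) (solve (p ∷ s ∷ [])))

criterion-B : ∀ {p s} → + 0 ≤ s → s ≤ p
            → (+ 0 < s × + 0 < Q (p - s) s) ⇔ Q s p < + 0
criterion-B {p} {s} 0≤s s≤p = mk⇔ to from
  where
  to : + 0 < s × + 0 < Q (p - s) s → Q s p < + 0
  to (_ , 0<Q) = ≰⇒> λ (0≤Q : + 0 ≤ Q s p) → refute 0
    (0≤+ (<⇒0≤ 0<Q) (≤⇒0≤ 0≤Q)) (solve (p ∷ s ∷ []))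
  from : Q s p < + 0 → + 0 < s × + 0 < Q (p - s) s
  from Q<0 =
      Q-neg⇒0<b 0≤s (≤-trans 0≤s s≤p) Q<0
    , 0≤⇒< (rearrange (Q (p - s) s - + 0 - + 1) (<⇒0≤ Q<0) (solve (p ∷ s ∷ [])))

gap-A : ∀ m n → (Φ -Φ ι (+ 1)) -Φ frac (m ·Φ Φ) (m + n - + 1)
              ≡ ((m - + 1) + (n - + 1)) ⊕ (- (m - + 1)) Φ
gap-A m n = ℤΦ-ext {(+ 0 - + 1) - (m * + 0 - (m + n - + 1))} {(+ 1 - + 0) - (m * + 1 - + 0)}
  (solve (m ∷ n ∷ [])) (solve (m ∷ []))

gap-B : ∀ m n → frac (n ·Φ Φ) m -Φ frac (m ·Φ Φ) (m + n - + 1)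
              ≡ (n - + 1) ⊕ (- ((m - + 1) - (n - + 1))) Φ
gap-B m n = ℤΦ-ext {(n * + 0 - m) - (m * + 0 - (m + n - + 1))} {(n * + 1 - + 0) - (m * + 1 - + 0)}
  (solve (m ∷ n ∷ [])) (solve (m ∷ n ∷ []))

-- For 1 ≤ n ≤ m and r = m + n - 1:  {mΦ} < Φ - 1  ⇔  {mΦ} < {nΦ},
-- because both sides are equivalent to  m - 1 < (n - 1)Φ.
frac-comparison : ∀ {n m} → + 0 < n → n ≤ m
  → (frac (m ·Φ Φ) (m + n - + 1) <Φ (Φ -Φ ι (+ 1)))
    ⇔ (frac (m ·Φ Φ) (m + n - + 1) <Φ frac (n ·Φ Φ) m)
frac-comparison {n} {m} 0<n n≤m = ⇔-trans side-A (⇔-sym side-B)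
  where
  s≤p : n - + 1 ≤ m - + 1
  s≤p = +-monoˡ-≤ (- + 1) n≤m
  0≤s : + 0 ≤ n - + 1
  0≤s = rearrange (n - + 1) (<⇒0≤ 0<n) (solve (n ∷ []))
  0≤p : + 0 ≤ m - + 1
  0≤p = ≤-trans 0≤s s≤p
  side-A : (frac (m ·Φ Φ) (m + n - + 1) <Φ (Φ -Φ ι (+ 1))) ⇔ Q (n - + 1) (m - + 1) < + 0
  side-A = ⇔-trans (positive-≡ (gap-A m n)) (⇔-trans (aboveΦ 0≤p) (criterion-A 0≤s 0≤p))
  side-B : (frac (m ·Φ Φ) (m + n - + 1) <Φ frac (n ·Φ Φ) m) ⇔ Q (n - + 1) (m - + 1) < + 0
  side-B = ⇔-trans (positive-≡ (gap-B m n)) (⇔-trans (aboveΦ (≤⇒0≤ s≤p)) (criterion-B 0≤s s≤p))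

proposition7 : (k : ℕ) (m r : ℤ)
    → IsFloor ((+ suc k) ·Φ Φ) m
    → IsFloor (m ·Φ Φ) r
    → (frac (m ·Φ Φ) r <Φ (Φ -Φ ι (+ 1)))
      ⇔ (frac (m ·Φ Φ) r <Φ frac ((+ suc k) ·Φ Φ) m)
proposition7 k m r floor-n floor-m =
  subst (λ x → (frac (m ·Φ Φ) x <Φ (Φ -Φ ι (+ 1))) ⇔ (frac (m ·Φ Φ) x <Φ frac (n ·Φ Φ) m))
        (sym r≡m+n-1) (frac-comparison 0<n n≤m)
  where
  n : ℤ
  n = + suc k
  0<n : + 0 < n
  0<n = +<+ (s≤s z≤n)
  n≤m : n ≤ m
  n≤m = proj₁ (floor-of-floor 0<n floor-n floor-m)
  r≡m+n-1 : r ≡ m + n - + 1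
  r≡m+n-1 = proj₂ (floor-of-floor 0<n floor-n floor-m)
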